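{- Let $d\geq 3$ and let $G$ be a $d$-regular graph on $n$ vertices with $d+1<n<2(d+1)$. Let $ab$ be an edge of $G$. (i) If $n<2d$, then $G$ has a triangle containing the edge $ab$. (ii) If $n=2d$, then $ab$ is contained in a triangle or in an induced $4$-cycle of $G$; furthermore, if $G$ is triangle-free then $G\cong K_{d,d}$. (iii) If $n=2d+1$, then $ab$ is contained in a triangle or in an induced $4$-cycle of $G$; furthermore, if $G$ is triangle-free then $G\cong T_{d,d,1}$.
   Context: All graphs are simple. An induced $4$-cycle is a set $U$ of 4 vertices such that the induced subgraph $G[U]$ is a 4-cycle. For an even integer $d\ge 2$, the graph $T_{d,d,1}$ is constructed as follows: take the complete bipartite graph $K_{d,d}$ with parts $\{a_1,\dots,a_d\}$ and $\{b_1,\dots,b_d\}$, delete the edges $a_ib_i$ for $i\in\{1,\dots,d/2\}$, add a new vertex $v$, and join $v$ to $a_i$ and $b_i$ for each $i\in\{1,\dots,d/2\}$. It is a $d$-regular graph on $2d+1$ vertices. -}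

module Defs where

open import Data.Nat using (ℕ; zero; suc; _+_; _<ᵇ_; ⌊_/2⌋)
open import Data.Fin using (Fin; toℕ; splitAt)
open import Data.Fin.Properties using (_≟_)
open import Data.Bool using (Bool; true; false; if_then_else_; not; _∧_)
open import Data.List using (List; map; allFin)
open import Data.Nat.ListAction using (sum)
open import Data.Sum using (_⊎_; inj₁; inj₂)
open import Data.Product using (Σ; ∃; ∃-syntax; _×_; _,_)
open import Data.Empty using (⊥)
open import Relation.Nullary using (¬_; does)
open import Relation.Binary.PropositionalEquality using (_≡_; _≢_)
open import Function.Bundles using (_⤖_; Bijection)

record Graph (n : ℕ) : Set where
  field
    adj   : Fin n → Fin n → Bool
    sym   : ∀ i j → adj i j ≡ adj j i
    irrefl : ∀ i → adj i i ≡ false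
open Graph public

_∼[_]_ : ∀ {n} → Fin n → Graph n → Fin n → Set
i ∼[ G ] j = adj G i j ≡ true

degree : ∀ {n} → Graph n → Fin n → ℕ
degree {n} G v = sum (map (λ j → if adj G v j then 1 else 0) (allFin n))

Regular : ∀ {n} → ℕ → Graph n → Set
Regular {n} d G = ∀ (v : Fin n) → degree G v ≡ d

EdgeInTriangle : ∀ {n} → Graph n → Fin n → Fin n → Set
EdgeInTriangle {n} G a b = ∃[ c ] (a ∼[ G ] c × b ∼[ G ] c)

EdgeInInducedC4 : ∀ {n} → Graph n → Fin n → Fin n → Set
EdgeInInducedC4 {n} G a b =
  ∃[ c ] ∃[ e ]
    ( a ≢ b × a ≢ c × a ≢ e × b ≢ c × b ≢ e × c ≢ e
    × a ∼[ G ] b × b ∼[ G ] c × c ∼[ G ] e × e ∼[ G ] a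
    × adj G a c ≡ false × adj G b e ≡ false )

TriangleFree : ∀ {n} → Graph n → Set
TriangleFree {n} G =
  ∀ (x y z : Fin n) → x ∼[ G ] y → y ∼[ G ] z → x ∼[ G ] z → ⊥

_≅_ : ∀ {n m} → Graph n → Graph m → Set
_≅_ {n} {m} G H =
  Σ (Fin n ⤖ Fin m) λ f →
    ∀ i j → adj G i j ≡ adj H (Bijection.to f i) (Bijection.to f j)

-- K_{d,d} on Fin (d + d): vertices 0..d-1 are a_1..a_d,
-- vertices d..2d-1 are b_1..b_d.

Kadj : (d : ℕ) → Fin (d + d) → Fin (d + d) → Bool
Kadj d i j with splitAt d i | splitAt d j
... | inj₁ _ | inj₁ _ = false
... | inj₁ _ | inj₂ _ = true
... | inj₂ _ | inj₁ _ = true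
... | inj₂ _ | inj₂ _ = false

Ksym : (d : ℕ) → ∀ i j → Kadj d i j ≡ Kadj d j i
Ksym d i j with splitAt d i | splitAt d j
... | inj₁ _ | inj₁ _ = Relation.Binary.PropositionalEquality.refl
... | inj₁ _ | inj₂ _ = Relation.Binary.PropositionalEquality.refl
... | inj₂ _ | inj₁ _ = Relation.Binary.PropositionalEquality.refl
... | inj₂ _ | inj₂ _ = Relation.Binary.PropositionalEquality.refl

Kirr : (d : ℕ) → ∀ i → Kadj d i i ≡ false
Kirr d i with splitAt d i
... | inj₁ _ = Relation.Binary.PropositionalEquality.refl
... | inj₂ _ = Relation.Binary.PropositionalEquality.refl

K : (d : ℕ) → Graph (d + d)
K d = record { adj = Kadj d ; sym = Ksym d ; irrefl = Kirr d }

-- T_{d,d,1} on Fin (d + d + 1): vertices 0..d-1 are a_1..a_d,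
-- d..2d-1 are b_1..b_d, and 2d is v.  With h = ⌊d/2⌋ (= d/2 for even d):
-- a_i b_j is an edge unless i = j ≤ h; v is adjacent to a_i and b_i for i ≤ h.

data TV (d : ℕ) : Set where
  A : Fin d → TV d
  B : Fin d → TV d
  V : TV d

tv : (d : ℕ) → Fin (d + d + 1) → TV d
tv d x with splitAt (d + d) x
... | inj₂ _ = V
... | inj₁ y with splitAt d y
...   | inj₁ i = A i
...   | inj₂ i = B i

small : (d : ℕ) → Fin d → Bool
small d i = toℕ i <ᵇ ⌊ d /2⌋

TVadj : (d : ℕ) → TV d → TV d → Bool
TVadj d (A i) (B j) = not (does (i ≟ j) ∧ small d i)
TVadj d (B j) (A i) = not (does (i ≟ j) ∧ small d i)
TVadj d V (A i) = small d i
TVadj d V (B i) = small d i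
TVadj d (A i) V = small d i
TVadj d (B i) V = small d i
TVadj d _ _ = false

Tsym' : (d : ℕ) → ∀ x y → TVadj d x y ≡ TVadj d y x
Tsym' d (A i) (A j) = Relation.Binary.PropositionalEquality.refl
Tsym' d (A i) (B j) = Relation.Binary.PropositionalEquality.refl
Tsym' d (A i) V = Relation.Binary.PropositionalEquality.refl
Tsym' d (B i) (A j) = Relation.Binary.PropositionalEquality.refl
Tsym' d (B i) (B j) = Relation.Binary.PropositionalEquality.refl
Tsym' d (B i) V = Relation.Binary.PropositionalEquality.refl
Tsym' d V (A j) = Relation.Binary.PropositionalEquality.refl
Tsym' d V (B j) = Relation.Binary.PropositionalEquality.refl
Tsym' d V V = Relation.Binary.PropositionalEquality.refl

Tirr' : (d : ℕ) → ∀ x → TVadj d x x ≡ false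
Tirr' d (A i) = Relation.Binary.PropositionalEquality.refl
Tirr' d (B i) = Relation.Binary.PropositionalEquality.refl
Tirr' d V = Relation.Binary.PropositionalEquality.refl

T : (d : ℕ) → Graph (d + d + 1)
T d = record
  { adj = λ x y → TVadj d (tv d x) (tv d y)
  ; sym = λ x y → Tsym' d (tv d x) (tv d y)
  ; irrefl = λ x → Tirr' d (tv d x)
  }

module Submission where

-- If a and b have no common neighbour, N(a) and N(b) are disjoint d-sets, so
-- n ≥ 2d; this gives (i). If moreover ab lies in no induced 4-cycle, then for
-- every c ∈ N(b) ∖ {a} the sets N(a) and N(c) meet at most in b, so the closed
-- neighbourhoods N[a] ∪ N[c] cover at least 2d + 1 vertices. For n = 2d this is
-- impossible; for n = 2d + 1 it forces the unique vertex w outside N(a) ∪ N(b)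
-- to be adjacent to every vertex of N(a) ∪ N(b) other than a and b, whence
-- 2d − 2 ≤ d.
--
-- If G is triangle-free and n = 2d, every vertex of N(b) has its d neighbours
-- inside N(a) = V ∖ N(b), so G is K_{d,d} with sides N(b) and its complement.
-- If G is triangle-free and n = 2d + 1, two non-adjacent vertices have a common
-- neighbour x (their closed neighbourhoods cannot be disjoint), and since N(x)
-- avoids both neighbourhoods they share at least d − 1 neighbours. Applied to
-- w and each of a, b inside N(w) this gives 2(d − 1) ≤ d, impossible for d ≥ 3:
-- the last clause of (iii) holds vacuously (T_{d,d,1} has triangles once d ≥ 4).

open import Data.Bool using (Bool; true; false; if_then_else_; not; _∧_; _∨_; _xor_)
open import Data.Bool.Properties using (¬-not; not-¬; not-involutive; ∨-zeroʳ; ∨-identityʳ) renaming (_≟_ to _≟ᵇ_)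
open import Data.Empty using (⊥; ⊥-elim)
open import Data.Fin using (Fin; zero; suc; join)
open import Data.Fin.Properties using (_≟_; any?; splitAt-join; +↔⊎)
open import Data.List using (map; allFin; tabulate)
open import Data.List.Properties using (map-tabulate)
open import Data.Nat using (ℕ; zero; suc; _+_; _*_; _≤_; _<_; z≤n; s≤s)
open import Data.Nat.ListAction using (sum)
open import Data.Nat.Properties hiding (_≟_)
open import Data.Product using (Σ; ∃; ∃-syntax; _×_; _,_)
open import Data.Sum using (_⊎_; inj₁; inj₂; map₁; map₂)
open import Function using (_∘_; id)
open import Relation.Nullary using (Dec; yes; no; does)
open import Relation.Nullary.Decidable using (_×-dec_; ¬?)
open import Relation.Binary.PropositionalEquality
open import Function.Bundles using (_↔_; Inverse; mk↔ₛ′)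
open import Function.Construct.Composition using (_↔-∘_)
open import Function.Construct.Symmetry using (↔-sym)
open import Function.Properties.Inverse using (↔⇒⤖)
open import Defs hiding (sym)

-- Subsets of Fin n are characteristic functions rather than the vectors of
-- Data.Fin.Subset, so that a row adj G v of a graph is the neighbourhood of v.
Subset : ℕ → Set
Subset n = Fin n → Bool

𝟙 : Bool → ℕ
𝟙 b = if b then 1 else 0

∣_∣ : ∀ {n} → Subset n → ℕ
∣_∣ {zero}  p = 0
∣_∣ {suc n} p = 𝟙 (p zero) + ∣ p ∘ suc ∣

module _ {n : ℕ} where

  infix  4 _∈_ _∉_ _⊆_
  infixr 7 _∩_
  infixr 6 _∪_

  _∈_ : Fin n → Subset n → Set
  i ∈ p = p i ≡ true

  _∉_ : Fin n → Subset n → Set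
  i ∉ p = p i ≡ false

  _∈?_ : ∀ i p → Dec (i ∈ p)
  i ∈? p = p i ≟ᵇ true

  _⊆_ : Subset n → Subset n → Set
  p ⊆ q = ∀ {i} → i ∈ p → i ∈ q

  Disjoint : Subset n → Subset n → Set
  Disjoint p q = ∀ {i} → i ∈ p → i ∈ q → ⊥

  ∅ ⊤ : Subset n
  ∅ _ = false
  ⊤ _ = true

  ⁅_⁆ : Fin n → Subset n
  ⁅ a ⁆ i = does (i ≟ a)

  ∁ : Subset n → Subset n
  ∁ p = not ∘ p

  _∪_ _∩_ : Subset n → Subset n → Subset n
  (p ∪ q) i = p i ∨ q i
  (p ∩ q) i = p i ∧ q i

  ∉∧∈⇒≢ : ∀ {i j} p → i ∉ p → j ∈ p → i ≢ j
  ∉∧∈⇒≢ p i∉p j∈p refl = not-¬ i∉p j∈p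

  ∈⁅⁆⇒≡ : ∀ {a} i → i ∈ ⁅ a ⁆ → i ≡ a
  ∈⁅⁆⇒≡ {a} i i∈⁅a⁆ with i ≟ a
  ... | yes i≡a = i≡a

  ∈-∪⁻ : ∀ {i} p q → i ∈ p ∪ q → i ∈ p ⊎ i ∈ q
  ∈-∪⁻ {i} p q i∈p∪q with p i
  ... | true  = inj₁ refl
  ... | false = inj₂ i∈p∪q

  ∈-∪⁺ˡ : ∀ {i} p q → i ∈ p → i ∈ p ∪ q
  ∈-∪⁺ˡ p q i∈p rewrite i∈p = refl

  ∈-∪⁅⁆⁺ : ∀ {i} p a → (i ≢ a → i ∈ p) → i ∈ p ∪ ⁅ a ⁆
  ∈-∪⁅⁆⁺ {i} p a h with i ≟ a
  ... | yes _  = ∨-zeroʳ (p i)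
  ... | no i≢a = trans (∨-identityʳ (p i)) (h i≢a)

  ∉-∪⁻ : ∀ {i} p q → i ∉ p ∪ q → i ∉ p × i ∉ q
  ∉-∪⁻ {i} p q i∉p∪q with p i
  ... | false = refl , i∉p∪q

  ∈-∩⁺ : ∀ {i} p q → i ∈ p → i ∈ q → i ∈ p ∩ q
  ∈-∩⁺ p q i∈p i∈q rewrite i∈p | i∈q = refl

  ∈-∩⁻ : ∀ {i} p q → i ∈ p ∩ q → i ∈ p × i ∈ q
  ∈-∩⁻ {i} p q i∈p∩q with p i | q i
  ... | true | true = refl , refl

∣p∣≤n : ∀ {n} (p : Subset n) → ∣ p ∣ ≤ n
∣p∣≤n {zero}  p = z≤n
∣p∣≤n {suc n} p with p zero
... | true  = s≤s (∣p∣≤n (p ∘ suc))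
... | false = m≤n⇒m≤1+n (∣p∣≤n (p ∘ suc))

∣∅∣≡0 : ∀ n → ∣ ∅ {n} ∣ ≡ 0
∣∅∣≡0 zero    = refl
∣∅∣≡0 (suc n) = ∣∅∣≡0 n

∣⊤∣≡n : ∀ n → ∣ ⊤ {n} ∣ ≡ n
∣⊤∣≡n zero    = refl
∣⊤∣≡n (suc n) = cong suc (∣⊤∣≡n n)

∣⁅x⁆∣≡1 : ∀ {n} (a : Fin n) → ∣ ⁅ a ⁆ ∣ ≡ 1
∣⁅x⁆∣≡1 {suc n} zero    = cong suc (∣∅∣≡0 n)
∣⁅x⁆∣≡1         (suc a) = ∣⁅x⁆∣≡1 a

∣p∣+∣∁p∣≡n : ∀ {n} (p : Subset n) → ∣ p ∣ + ∣ ∁ p ∣ ≡ n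
∣p∣+∣∁p∣≡n {zero}  p = refl
∣p∣+∣∁p∣≡n {suc n} p with p zero
... | true  = cong suc (∣p∣+∣∁p∣≡n (p ∘ suc))
... | false = trans (+-suc _ _) (cong suc (∣p∣+∣∁p∣≡n (p ∘ suc)))

p⊆q⇒∣p∣≤∣q∣ : ∀ {n} (p q : Subset n) → p ⊆ q → ∣ p ∣ ≤ ∣ q ∣
p⊆q⇒∣p∣≤∣q∣ {zero}  p q p⊆q = z≤n
p⊆q⇒∣p∣≤∣q∣ {suc n} p q p⊆q with p zero in p0 | q zero in q0
... | false | _     = ≤-trans (p⊆q⇒∣p∣≤∣q∣ (p ∘ suc) (q ∘ suc) p⊆q) (m≤n+m _ _)
... | true  | true  = s≤s (p⊆q⇒∣p∣≤∣q∣ (p ∘ suc) (q ∘ suc) p⊆q)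
... | true  | false = ⊥-elim (not-¬ q0 (p⊆q p0))

∣p∪q∣+∣p∩q∣≡∣p∣+∣q∣ : ∀ {n} (p q : Subset n) → ∣ p ∪ q ∣ + ∣ p ∩ q ∣ ≡ ∣ p ∣ + ∣ q ∣
∣p∪q∣+∣p∩q∣≡∣p∣+∣q∣ {zero}  p q = refl
∣p∪q∣+∣p∩q∣≡∣p∣+∣q∣ {suc n} p q =
  step (p zero) (q zero) (∣p∪q∣+∣p∩q∣≡∣p∣+∣q∣ (p ∘ suc) (q ∘ suc))
  where
  step : ∀ x y {u i k l} → u + i ≡ k + l → (𝟙 (x ∨ y) + u) + (𝟙 (x ∧ y) + i) ≡ (𝟙 x + k) + (𝟙 y + l)
  step false false eq = eq
  step true  false eq = cong suc eq
  step false true  eq = trans (cong suc eq) (sym (+-suc _ _))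
  step true  true  eq = cong suc (trans (+-suc _ _) (trans (cong suc eq) (sym (+-suc _ _))))

∣p∪q∣≤∣p∣+∣q∣ : ∀ {n} (p q : Subset n) → ∣ p ∪ q ∣ ≤ ∣ p ∣ + ∣ q ∣
∣p∪q∣≤∣p∣+∣q∣ p q = ≤-trans (m≤m+n _ _) (≤-reflexive (∣p∪q∣+∣p∩q∣≡∣p∣+∣q∣ p q))

Disjoint⇒∣p∪q∣≡∣p∣+∣q∣ : ∀ {n} (p q : Subset n) → Disjoint p q → ∣ p ∪ q ∣ ≡ ∣ p ∣ + ∣ q ∣
Disjoint⇒∣p∪q∣≡∣p∣+∣q∣ {n} p q p#q = begin
  ∣ p ∪ q ∣           ≡⟨ +-identityʳ _ ⟨
  ∣ p ∪ q ∣ + 0       ≡⟨ cong (∣ p ∪ q ∣ +_) ∣p∩q∣≡0 ⟨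
  ∣ p ∪ q ∣ + ∣ p ∩ q ∣ ≡⟨ ∣p∪q∣+∣p∩q∣≡∣p∣+∣q∣ p q ⟩
  ∣ p ∣ + ∣ q ∣       ∎
  where
  open ≡-Reasoning
  p∩q⊆∅ : p ∩ q ⊆ ∅
  p∩q⊆∅ {i} i∈p∩q = ⊥-elim (let i∈p , i∈q = ∈-∩⁻ p q i∈p∩q in p#q i∈p i∈q)
  ∣p∩q∣≡0 : ∣ p ∩ q ∣ ≡ 0
  ∣p∩q∣≡0 = n≤0⇒n≡0 (≤-trans (p⊆q⇒∣p∣≤∣q∣ (p ∩ q) ∅ p∩q⊆∅) (≤-reflexive (∣∅∣≡0 n)))

∣p∪⁅x⁆∣≤∣p∣+1 : ∀ {n} (p : Subset n) a → ∣ p ∪ ⁅ a ⁆ ∣ ≤ ∣ p ∣ + 1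
∣p∪⁅x⁆∣≤∣p∣+1 p a = ≤-trans (∣p∪q∣≤∣p∣+∣q∣ p ⁅ a ⁆) (≤-reflexive (cong (∣ p ∣ +_) (∣⁅x⁆∣≡1 a)))

p⊂q⇒∣p∣<∣q∣ : ∀ {n} (p q : Subset n) {i} → p ⊆ q → i ∉ p → i ∈ q → ∣ p ∣ < ∣ q ∣
p⊂q⇒∣p∣<∣q∣ p q {i} p⊆q i∉p i∈q = begin-strict
  ∣ p ∣                 <⟨ m<m+n _ (s≤s z≤n) ⟩
  ∣ p ∣ + 1             ≡⟨ cong (∣ p ∣ +_) (∣⁅x⁆∣≡1 i) ⟨
  ∣ p ∣ + ∣ ⁅ i ⁆ ∣     ≡⟨ Disjoint⇒∣p∪q∣≡∣p∣+∣q∣ p ⁅ i ⁆ p#⁅i⁆ ⟨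
  ∣ p ∪ ⁅ i ⁆ ∣         ≤⟨ p⊆q⇒∣p∣≤∣q∣ (p ∪ ⁅ i ⁆) q p∪⁅i⁆⊆q ⟩
  ∣ q ∣                 ∎
  where
  open ≤-Reasoning
  p#⁅i⁆ : Disjoint p ⁅ i ⁆
  p#⁅i⁆ {j} j∈p j∈⁅i⁆ with ∈⁅⁆⇒≡ j j∈⁅i⁆
  ... | refl = not-¬ i∉p j∈p
  p∪⁅i⁆⊆q : p ∪ ⁅ i ⁆ ⊆ q
  p∪⁅i⁆⊆q {j} j∈p∪⁅i⁆ with ∈-∪⁻ p ⁅ i ⁆ j∈p∪⁅i⁆
  ... | inj₁ j∈p    = p⊆q j∈p
  ... | inj₂ j∈⁅i⁆ with ∈⁅⁆⇒≡ j j∈⁅i⁆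
  ...   | refl = i∈q

p⊆q∧∣q∣≤∣p∣⇒q⊆p : ∀ {n} (p q : Subset n) → p ⊆ q → ∣ q ∣ ≤ ∣ p ∣ → q ⊆ p
p⊆q∧∣q∣≤∣p∣⇒q⊆p p q p⊆q ∣q∣≤∣p∣ {i} i∈q =
  ¬-not {y = false} λ i∉p → <⇒≱ (p⊂q⇒∣p∣<∣q∣ p q p⊆q i∉p i∈q) ∣q∣≤∣p∣

n≤∣p∣⇒∈ : ∀ {n} (p : Subset n) → n ≤ ∣ p ∣ → ∀ i → i ∈ p
n≤∣p∣⇒∈ {n} p n≤∣p∣ i =
  p⊆q∧∣q∣≤∣p∣⇒q⊆p p ⊤ (λ _ → refl) (≤-trans (≤-reflexive (∣⊤∣≡n n)) n≤∣p∣) {i} refl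

0<∣p∣⇒∃∈ : ∀ {n} (p : Subset n) → 0 < ∣ p ∣ → ∃ (_∈ p)
0<∣p∣⇒∃∈ {n} p 0<∣p∣ with any? (_∈? p)
... | yes i∈p = i∈p
... | no  ∄   = ⊥-elim (<⇒≱ 0<∣p∣ (≤-trans (p⊆q⇒∣p∣≤∣q∣ p ∅ p⊆∅) (≤-reflexive (∣∅∣≡0 n))))
  where
  p⊆∅ : p ⊆ ∅
  p⊆∅ {i} i∈p = ⊥-elim (∄ (i , i∈p))

∣p∣<n⇒∃∉ : ∀ {n} (p : Subset n) → ∣ p ∣ < n → ∃ (_∉ p)
∣p∣<n⇒∃∉ {n} p ∣p∣<n with 0<∣p∣⇒∃∈ (∁ p) 0<∣∁p∣
  where
  0<∣∁p∣ : 0 < ∣ ∁ p ∣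
  0<∣∁p∣ = +-cancelˡ-< (∣ p ∣) 0 (∣ ∁ p ∣) (begin-strict
    ∣ p ∣ + 0         ≡⟨ +-identityʳ _ ⟩
    ∣ p ∣             <⟨ ∣p∣<n ⟩
    n                 ≡⟨ ∣p∣+∣∁p∣≡n p ⟨
    ∣ p ∣ + ∣ ∁ p ∣   ∎)
    where open ≤-Reasoning
... | i , i∈∁p = i , trans (sym (not-involutive (p i))) (cong not i∈∁p)

1<∣p∣⇒∃≢ : ∀ {n} (p : Subset n) (a : Fin n) → 1 < ∣ p ∣ → ∃[ i ] i ∈ p × i ≢ a
1<∣p∣⇒∃≢ p a 1<∣p∣ with any? (λ i → (i ∈? p) ×-dec ¬? (i ≟ a))
... | yes (i , i∈p , i≢a) = i , i∈p , i≢a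
... | no  ∄ = ⊥-elim (<⇒≱ 1<∣p∣ (≤-trans (p⊆q⇒∣p∣≤∣q∣ p ⁅ a ⁆ p⊆⁅a⁆) (≤-reflexive (∣⁅x⁆∣≡1 a))))
  where
  p⊆⁅a⁆ : p ⊆ ⁅ a ⁆
  p⊆⁅a⁆ {i} i∈p with i ≟ a
  ... | yes _  = refl
  ... | no i≢a = ⊥-elim (∄ (i , i∈p , i≢a))

sum-𝟙∘p≡∣p∣ : ∀ {n} (p : Subset n) → sum (map (𝟙 ∘ p) (allFin n)) ≡ ∣ p ∣
sum-𝟙∘p≡∣p∣ {zero}  p = refl
sum-𝟙∘p≡∣p∣ {suc n} p = cong (𝟙 (p zero) +_) (begin
  sum (map (𝟙 ∘ p) (tabulate suc))       ≡⟨ cong sum (map-tabulate suc (𝟙 ∘ p)) ⟩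
  sum (tabulate (𝟙 ∘ p ∘ suc))           ≡⟨ cong sum (map-tabulate id (𝟙 ∘ p ∘ suc)) ⟨
  sum (map (𝟙 ∘ p ∘ suc) (allFin n))     ≡⟨ sum-𝟙∘p≡∣p∣ (p ∘ suc) ⟩
  ∣ p ∘ suc ∣                            ∎)
  where open ≡-Reasoning

is-inj₁ : ∀ {A B : Set} → A ⊎ B → Bool
is-inj₁ (inj₁ _) = true
is-inj₁ (inj₂ _) = false

-- sortBy p sends i to its rank within p or within ∁ p; one step of the
-- recursion puts vertex zero first on the side chosen by p zero.
private
  Slot : Bool → ℕ → ℕ → Set
  Slot b k m = Fin (𝟙 b + k) ⊎ Fin (𝟙 (not b) + m)

  fresh : ∀ b {k m} → Slot b k m
  fresh true  = inj₁ zero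
  fresh false = inj₂ zero

  shift : ∀ b {k m} → Fin k ⊎ Fin m → Slot b k m
  shift true  = map₁ suc
  shift false = map₂ suc

  extend : ∀ b {n k m} → (Fin n → Fin k ⊎ Fin m) → Fin (suc n) → Slot b k m
  extend b f zero    = fresh b
  extend b f (suc i) = shift b (f i)

  unextend : ∀ b {n k m} → (Fin k ⊎ Fin m → Fin n) → Slot b k m → Fin (suc n)
  unextend true  g (inj₁ zero)    = zero
  unextend true  g (inj₁ (suc x)) = suc (g (inj₁ x))
  unextend true  g (inj₂ y)       = suc (g (inj₂ y))
  unextend false g (inj₁ x)       = suc (g (inj₁ x))
  unextend false g (inj₂ zero)    = zero
  unextend false g (inj₂ (suc y)) = suc (g (inj₂ y))

  unextend∘extend : ∀ b {n k m} (f : Fin n → Fin k ⊎ Fin m) g →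
                    (∀ i → g (f i) ≡ i) → ∀ i → unextend b g (extend b f i) ≡ i
  unextend∘extend true  f g gf zero = refl
  unextend∘extend false f g gf zero = refl
  unextend∘extend b     f g gf (suc i) with f i | gf i
  unextend∘extend true  f g gf (suc i) | inj₁ _ | eq = cong suc eq
  unextend∘extend true  f g gf (suc i) | inj₂ _ | eq = cong suc eq
  unextend∘extend false f g gf (suc i) | inj₁ _ | eq = cong suc eq
  unextend∘extend false f g gf (suc i) | inj₂ _ | eq = cong suc eq

  extend∘unextend : ∀ b {n k m} (f : Fin n → Fin k ⊎ Fin m) g →
                    (∀ x → f (g x) ≡ x) → ∀ x → extend b f (unextend b g x) ≡ x
  extend∘unextend true  f g fg (inj₁ zero)    = refl
  extend∘unextend true  f g fg (inj₁ (suc x)) = cong (shift true) (fg (inj₁ x))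
  extend∘unextend true  f g fg (inj₂ y)       = cong (shift true) (fg (inj₂ y))
  extend∘unextend false f g fg (inj₁ x)       = cong (shift false) (fg (inj₁ x))
  extend∘unextend false f g fg (inj₂ zero)    = refl
  extend∘unextend false f g fg (inj₂ (suc y)) = cong (shift false) (fg (inj₂ y))

  is-inj₁-fresh : ∀ b {k m} → is-inj₁ (fresh b {k} {m}) ≡ b
  is-inj₁-fresh true  = refl
  is-inj₁-fresh false = refl

  is-inj₁-shift : ∀ b {k m} (x : Fin k ⊎ Fin m) → is-inj₁ (shift b x) ≡ is-inj₁ x
  is-inj₁-shift true  (inj₁ _) = refl
  is-inj₁-shift true  (inj₂ _) = refl
  is-inj₁-shift false (inj₁ _) = refl
  is-inj₁-shift false (inj₂ _) = refl

sortBy : ∀ {n} (p : Subset n) → Fin n → Fin ∣ p ∣ ⊎ Fin ∣ ∁ p ∣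
sortBy {suc n} p = extend (p zero) (sortBy (p ∘ suc))

unsortBy : ∀ {n} (p : Subset n) → Fin ∣ p ∣ ⊎ Fin ∣ ∁ p ∣ → Fin n
unsortBy {zero}  p (inj₁ ())
unsortBy {zero}  p (inj₂ ())
unsortBy {suc n} p = unextend (p zero) (unsortBy (p ∘ suc))

unsortBy∘sortBy : ∀ {n} (p : Subset n) i → unsortBy p (sortBy p i) ≡ i
unsortBy∘sortBy {suc n} p =
  unextend∘extend (p zero) (sortBy (p ∘ suc)) (unsortBy (p ∘ suc)) (unsortBy∘sortBy (p ∘ suc))

sortBy∘unsortBy : ∀ {n} (p : Subset n) x → sortBy p (unsortBy p x) ≡ x
sortBy∘unsortBy {zero}  p (inj₁ ())
sortBy∘unsortBy {zero}  p (inj₂ ())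
sortBy∘unsortBy {suc n} p =
  extend∘unextend (p zero) (sortBy (p ∘ suc)) (unsortBy (p ∘ suc)) (sortBy∘unsortBy (p ∘ suc))

is-inj₁∘sortBy : ∀ {n} (p : Subset n) i → is-inj₁ (sortBy p i) ≡ p i
is-inj₁∘sortBy {suc n} p zero    = is-inj₁-fresh (p zero)
is-inj₁∘sortBy {suc n} p (suc i) =
  trans (is-inj₁-shift (p zero) (sortBy (p ∘ suc) i)) (is-inj₁∘sortBy (p ∘ suc) i)

Kadj-join : ∀ d (x y : Fin d ⊎ Fin d) → Kadj d (join d d x) (join d d y) ≡ is-inj₁ x xor is-inj₁ y
Kadj-join d x y rewrite splitAt-join d d x | splitAt-join d d y with x | y
... | inj₁ _ | inj₁ _ = refl
... | inj₁ _ | inj₂ _ = refl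
... | inj₂ _ | inj₁ _ = refl
... | inj₂ _ | inj₂ _ = refl

sortBy↔ : ∀ {n k m} (p : Subset n) → ∣ p ∣ ≡ k → ∣ ∁ p ∣ ≡ m →
          Σ (Fin n ↔ (Fin k ⊎ Fin m)) λ f → ∀ i → is-inj₁ (Inverse.to f i) ≡ p i
sortBy↔ p refl refl =
  mk↔ₛ′ (sortBy p) (unsortBy p) (sortBy∘unsortBy p) (unsortBy∘sortBy p) , is-inj₁∘sortBy p

bipartition⇒≅K : ∀ {n d} (G : Graph n) (p : Subset n) → ∣ p ∣ ≡ d → ∣ ∁ p ∣ ≡ d →
                 (∀ i j → adj G i j ≡ p i xor p j) → G ≅ K d
bipartition⇒≅K {d = d} G p ∣p∣≡d ∣∁p∣≡d adj≡xor with sortBy↔ p ∣p∣≡d ∣∁p∣≡d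
... | f , side = ↔⇒⤖ (↔-sym +↔⊎ ↔-∘ f) , λ i j → begin
  adj G i j                           ≡⟨ adj≡xor i j ⟩
  p i xor p j                         ≡⟨ cong₂ _xor_ (side i) (side j) ⟨
  is-inj₁ (to i) xor is-inj₁ (to j)   ≡⟨ Kadj-join d (to i) (to j) ⟨
  Kadj d (join d d (to i)) (join d d (to j)) ∎
  where
  open ≡-Reasoning
  open Inverse f using (to)

module Neighbourhoods {n : ℕ} (G : Graph n) where

  N : Fin n → Subset n
  N = adj G

  N[_] : Fin n → Subset n
  N[ v ] = N v ∪ ⁅ v ⁆

  ∼-sym : ∀ {a b} → a ∼[ G ] b → b ∼[ G ] a
  ∼-sym {a} {b} ab = trans (Graph.sym G b a) ab

  ∼⇒≢ : ∀ {a b} → a ∼[ G ] b → a ≢ b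
  ∼⇒≢ {a} ab refl = not-¬ (irrefl G a) ab

  ∈N[]⇒∈N : ∀ {v i} → i ∈ N[ v ] → i ≢ v → i ∈ N v
  ∈N[]⇒∈N {v} {i} i∈N[v] i≢v with ∈-∪⁻ (N v) ⁅ v ⁆ i∈N[v]
  ... | inj₁ i∈Nv   = i∈Nv
  ... | inj₂ i∈⁅v⁆ = ⊥-elim (i≢v (∈⁅⁆⇒≡ i i∈⁅v⁆))

  triangle-or-disjoint : ∀ a b → EdgeInTriangle G a b ⊎ Disjoint (N a) (N b)
  triangle-or-disjoint a b with any? (λ c → (c ∈? N a) ×-dec (c ∈? N b))
  ... | yes (c , ac , bc) = inj₁ (c , ac , bc)
  ... | no  ∄             = inj₂ λ {c} ac bc → ∄ (c , ac , bc)

  TriangleFree⇒Disjoint : TriangleFree G → ∀ {a b} → a ∼[ G ] b → Disjoint (N a) (N b)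
  TriangleFree⇒Disjoint tf {a} {b} ab {c} ac bc = tf a b c ab bc ac

  NoCrossEdges : Fin n → Fin n → Set
  NoCrossEdges a b = ∀ {c e} → c ∈ N b → c ≢ a → e ∈ N a → e ≢ b → e ∉ N c

  NoCrossEdges-sym : ∀ {a b} → NoCrossEdges a b → NoCrossEdges b a
  NoCrossEdges-sym none {c} {e} ac c≢b be e≢a = trans (Graph.sym G c e) (none be e≢a ac c≢b)

  induced-C4-or-NoCrossEdges : ∀ {a b} → a ∼[ G ] b → Disjoint (N a) (N b) →
                               EdgeInInducedC4 G a b ⊎ NoCrossEdges a b
  induced-C4-or-NoCrossEdges {a} {b} ab a#b
    with any? (λ c → any? λ e →
           (c ∈? N b) ×-dec ¬? (c ≟ a) ×-dec (e ∈? N a) ×-dec ¬? (e ≟ b) ×-dec (e ∈? N c))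
  ... | yes (c , e , bc , c≢a , ae , e≢b , ce) =
    inj₁ ( c , e , ∼⇒≢ ab , c≢a ∘ sym , ∼⇒≢ ae , ∼⇒≢ bc , e≢b ∘ sym , ∼⇒≢ ce
         , ab , bc , ce , ∼-sym ae
         , ¬-not (λ ac → a#b ac bc) , ¬-not (λ be → a#b ae be) )
  ... | no ∄ = inj₂ λ {c} {e} bc c≢a ae e≢b → ¬-not λ ce → ∄ (c , e , bc , c≢a , ae , e≢b , ce)

module RegularGraph {n : ℕ} (G : Graph n) {d : ℕ} (regular : Regular d G) where
  open Neighbourhoods G

  ∣N∣≡d : ∀ v → ∣ N v ∣ ≡ d
  ∣N∣≡d v = trans (sym (sum-𝟙∘p≡∣p∣ (N v))) (regular v)

  ∣N[]∣≡1+d : ∀ v → ∣ N[ v ] ∣ ≡ suc d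
  ∣N[]∣≡1+d v = begin
    ∣ N v ∪ ⁅ v ⁆ ∣       ≡⟨ Disjoint⇒∣p∪q∣≡∣p∣+∣q∣ (N v) ⁅ v ⁆ Nv#⁅v⁆ ⟩
    ∣ N v ∣ + ∣ ⁅ v ⁆ ∣   ≡⟨ cong₂ _+_ (∣N∣≡d v) (∣⁅x⁆∣≡1 v) ⟩
    d + 1                 ≡⟨ +-comm d 1 ⟩
    suc d                 ∎
    where
    open ≡-Reasoning
    Nv#⁅v⁆ : Disjoint (N v) ⁅ v ⁆
    Nv#⁅v⁆ {i} vi i∈⁅v⁆ = ∼⇒≢ vi (sym (∈⁅⁆⇒≡ i i∈⁅v⁆))

  ∣N∪N∣+∣N∩N∣≡2d : ∀ u w → ∣ N u ∪ N w ∣ + ∣ N u ∩ N w ∣ ≡ d + d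
  ∣N∪N∣+∣N∩N∣≡2d u w = trans (∣p∪q∣+∣p∩q∣≡∣p∣+∣q∣ (N u) (N w)) (cong₂ _+_ (∣N∣≡d u) (∣N∣≡d w))

  Disjoint⇒∣N∪N∣≡2d : ∀ {a b} → Disjoint (N a) (N b) → ∣ N a ∪ N b ∣ ≡ d + d
  Disjoint⇒∣N∪N∣≡2d {a} {b} a#b =
    trans (Disjoint⇒∣p∪q∣≡∣p∣+∣q∣ (N a) (N b) a#b) (cong₂ _+_ (∣N∣≡d a) (∣N∣≡d b))

  Disjoint⇒∃outside : ∀ {a b} → Disjoint (N a) (N b) → n ≡ suc (d + d) → ∃[ w ] w ∉ N a × w ∉ N b
  Disjoint⇒∃outside {a} {b} a#b n≡2d+1 with ∣p∣<n⇒∃∉ (N a ∪ N b) ∣Na∪Nb∣<n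
    where
    ∣Na∪Nb∣<n : ∣ N a ∪ N b ∣ < n
    ∣Na∪Nb∣<n = subst₂ _<_ (sym (Disjoint⇒∣N∪N∣≡2d a#b)) (sym n≡2d+1) (n<1+n (d + d))
  ... | w , w∉Na∪Nb = w , ∉-∪⁻ (N a) (N b) w∉Na∪Nb

  N[u]∩N[w]⊆Nu∩Nw : ∀ {u w} → u ≢ w → w ∉ N u → N[ u ] ∩ N[ w ] ⊆ N u ∩ N w
  N[u]∩N[w]⊆Nu∩Nw {u} {w} u≢w w∉Nu {i} i∈ with ∈-∩⁻ N[ u ] N[ w ] i∈
  ... | i∈N[u] , i∈N[w] = ∈-∩⁺ (N u) (N w) (∈N[]⇒∈N i∈N[u] i≢u) (∈N[]⇒∈N i∈N[w] i≢w)
    where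
    i≢u : i ≢ u
    i≢u refl = not-¬ w∉Nu (∼-sym (∈N[]⇒∈N i∈N[w] u≢w))
    i≢w : i ≢ w
    i≢w refl = not-¬ w∉Nu (∈N[]⇒∈N i∈N[u] (u≢w ∘ sym))

  ∣N[u]∪N[w]∣+∣Nu∩Nw∣≡2+2d : ∀ {u w} → u ≢ w → w ∉ N u →
                              ∣ N[ u ] ∪ N[ w ] ∣ + ∣ N u ∩ N w ∣ ≡ suc (suc (d + d))
  ∣N[u]∪N[w]∣+∣Nu∩Nw∣≡2+2d {u} {w} u≢w w∉Nu = begin
    ∣ N[ u ] ∪ N[ w ] ∣ + ∣ N u ∩ N w ∣         ≡⟨ cong (∣ N[ u ] ∪ N[ w ] ∣ +_) closed≡open ⟨
    ∣ N[ u ] ∪ N[ w ] ∣ + ∣ N[ u ] ∩ N[ w ] ∣   ≡⟨ ∣p∪q∣+∣p∩q∣≡∣p∣+∣q∣ N[ u ] N[ w ] ⟩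
    ∣ N[ u ] ∣ + ∣ N[ w ] ∣                    ≡⟨ cong₂ _+_ (∣N[]∣≡1+d u) (∣N[]∣≡1+d w) ⟩
    suc d + suc d                             ≡⟨ cong suc (+-suc d d) ⟩
    suc (suc (d + d))                         ∎
    where
    open ≡-Reasoning
    closed≡open : ∣ N[ u ] ∩ N[ w ] ∣ ≡ ∣ N u ∩ N w ∣
    closed≡open = ≤-antisym
      (p⊆q⇒∣p∣≤∣q∣ (N[ u ] ∩ N[ w ]) (N u ∩ N w) (N[u]∩N[w]⊆Nu∩Nw u≢w w∉Nu))
      (p⊆q⇒∣p∣≤∣q∣ (N u ∩ N w) (N[ u ] ∩ N[ w ]) λ {i} i∈ →
        let ui , wi = ∈-∩⁻ (N u) (N w) i∈ in
        ∈-∩⁺ N[ u ] N[ w ] (∈-∪⁺ˡ (N u) ⁅ u ⁆ ui) (∈-∪⁺ˡ (N w) ⁅ w ⁆ wi))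

  module _ {a b : Fin n} (ab : a ∼[ G ] b) (a#b : Disjoint (N a) (N b)) (none : NoCrossEdges a b)
           where

    2d<∣N[a]∪N[c]∣ : ∀ {c} → c ∈ N b → c ≢ a → d + d < ∣ N[ a ] ∪ N[ c ] ∣
    2d<∣N[a]∪N[c]∣ {c} bc c≢a = ≤-pred (begin
      suc (suc (d + d))                     ≡⟨ ∣N[u]∪N[w]∣+∣Nu∩Nw∣≡2+2d (c≢a ∘ sym) c∉Na ⟨
      ∣ N[ a ] ∪ N[ c ] ∣ + ∣ N a ∩ N c ∣   ≤⟨ +-monoʳ-≤ ∣ N[ a ] ∪ N[ c ] ∣ ∣Na∩Nc∣≤1 ⟩
      ∣ N[ a ] ∪ N[ c ] ∣ + 1               ≡⟨ +-comm _ 1 ⟩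
      suc ∣ N[ a ] ∪ N[ c ] ∣               ∎)
      where
      open ≤-Reasoning
      c∉Na : c ∉ N a
      c∉Na = ¬-not λ ac → a#b ac bc
      Na∩Nc⊆⁅b⁆ : N a ∩ N c ⊆ ⁅ b ⁆
      Na∩Nc⊆⁅b⁆ {e} e∈ with e ≟ b
      ... | yes _  = refl
      ... | no e≢b = let ae , ce = ∈-∩⁻ (N a) (N c) e∈ in ⊥-elim (not-¬ (none bc c≢a ae e≢b) ce)
      ∣Na∩Nc∣≤1 : ∣ N a ∩ N c ∣ ≤ 1
      ∣Na∩Nc∣≤1 = ≤-trans (p⊆q⇒∣p∣≤∣q∣ (N a ∩ N c) ⁅ b ⁆ Na∩Nc⊆⁅b⁆) (≤-reflexive (∣⁅x⁆∣≡1 b))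

    NoCrossEdges⇒2d<n : 2 ≤ d → d + d < n
    NoCrossEdges⇒2d<n 2≤d with 1<∣p∣⇒∃≢ (N b) a (subst (1 <_) (sym (∣N∣≡d b)) 2≤d)
    ... | c , bc , c≢a = <-≤-trans (2d<∣N[a]∪N[c]∣ bc c≢a) (∣p∣≤n (N[ a ] ∪ N[ c ]))

    NoCrossEdges⇒outside∈N : n ≡ suc (d + d) → ∀ {w c} → w ∉ N a → w ∉ N b →
                             c ∈ N b → c ≢ a → w ∈ N c
    NoCrossEdges⇒outside∈N n≡2d+1 {w} {c} w∉Na w∉Nb bc c≢a
      with ∈-∪⁻ N[ a ] N[ c ] (n≤∣p∣⇒∈ (N[ a ] ∪ N[ c ]) n≤∣N[a]∪N[c]∣ w)
      where
      n≤∣N[a]∪N[c]∣ : n ≤ ∣ N[ a ] ∪ N[ c ] ∣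
      n≤∣N[a]∪N[c]∣ = subst (_≤ ∣ N[ a ] ∪ N[ c ] ∣) (sym n≡2d+1) (2d<∣N[a]∪N[c]∣ bc c≢a)
    ... | inj₁ w∈N[a] = ⊥-elim (not-¬ w∉Na (∈N[]⇒∈N w∈N[a] (∉∧∈⇒≢ (N b) w∉Nb (∼-sym ab))))
    ... | inj₂ w∈N[c] = ∈N[]⇒∈N w∈N[c] (∉∧∈⇒≢ (N b) w∉Nb bc)

  NoCrossEdges⇒n≢2d+1 : 3 ≤ d → ∀ {a b} → a ∼[ G ] b → Disjoint (N a) (N b) → NoCrossEdges a b →
                        n ≢ suc (d + d)
  NoCrossEdges⇒n≢2d+1 3≤d {a} {b} ab a#b none n≡2d+1
    with Disjoint⇒∃outside a#b n≡2d+1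
  ... | w , w∉Na , w∉Nb = <⇒≱ 3≤d (+-cancelˡ-≤ d d 2 (begin
    d + d                                 ≡⟨ Disjoint⇒∣N∪N∣≡2d a#b ⟨
    ∣ N a ∪ N b ∣                         ≤⟨ p⊆q⇒∣p∣≤∣q∣ (N a ∪ N b) ((N w ∪ ⁅ a ⁆) ∪ ⁅ b ⁆) Na∪Nb⊆ ⟩
    ∣ (N w ∪ ⁅ a ⁆) ∪ ⁅ b ⁆ ∣             ≤⟨ ∣p∪⁅x⁆∣≤∣p∣+1 (N w ∪ ⁅ a ⁆) b ⟩
    ∣ N w ∪ ⁅ a ⁆ ∣ + 1                   ≤⟨ +-monoˡ-≤ 1 (∣p∪⁅x⁆∣≤∣p∣+1 (N w) a) ⟩
    ∣ N w ∣ + 1 + 1                       ≡⟨ cong (λ k → k + 1 + 1) (∣N∣≡d w) ⟩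
    d + 1 + 1                             ≡⟨ +-assoc d 1 1 ⟩
    d + 2                                 ∎))
    where
    open ≤-Reasoning
    Na∪Nb⊆ : N a ∪ N b ⊆ (N w ∪ ⁅ a ⁆) ∪ ⁅ b ⁆
    Na∪Nb⊆ {x} x∈ = ∈-∪⁅⁆⁺ (N w ∪ ⁅ a ⁆) b λ x≢b → ∈-∪⁅⁆⁺ (N w) a λ x≢a → ∼-sym (x∈Nw x≢a x≢b)
      where
      x∈Nw : x ≢ a → x ≢ b → w ∈ N x
      x∈Nw x≢a x≢b with ∈-∪⁻ (N a) (N b) x∈
      ... | inj₁ ax = NoCrossEdges⇒outside∈N (∼-sym ab) (λ bi ai → a#b ai bi) (NoCrossEdges-sym none)
                        n≡2d+1 w∉Nb w∉Na ax x≢b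
      ... | inj₂ bx = NoCrossEdges⇒outside∈N ab a#b none n≡2d+1 w∉Na w∉Nb bx x≢a

  triangle-or-induced-C4 : 3 ≤ d → n ≡ d + d ⊎ n ≡ suc (d + d) → ∀ {a b} → a ∼[ G ] b →
                           EdgeInTriangle G a b ⊎ EdgeInInducedC4 G a b
  triangle-or-induced-C4 3≤d n≡ {a} {b} ab with triangle-or-disjoint a b
  ... | inj₁ abc = inj₁ abc
  ... | inj₂ a#b with induced-C4-or-NoCrossEdges ab a#b | n≡
  ...   | inj₁ c4   | _           = inj₂ c4
  ...   | inj₂ none | inj₁ n≡2d   =
    ⊥-elim (<-irrefl (sym n≡2d) (NoCrossEdges⇒2d<n ab a#b none (<⇒≤ 3≤d)))
  ...   | inj₂ none | inj₂ n≡2d+1 = ⊥-elim (NoCrossEdges⇒n≢2d+1 3≤d ab a#b none n≡2d+1)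

  module _ (tf : TriangleFree G) where

    common-neighbour⇒d+∣Nu∪Nw∣≤n : ∀ {x u w} → u ∈ N x → w ∈ N x → d + ∣ N u ∪ N w ∣ ≤ n
    common-neighbour⇒d+∣Nu∪Nw∣≤n {x} {u} {w} xu xw = begin
      d + ∣ N u ∪ N w ∣            ≡⟨ cong (_+ ∣ N u ∪ N w ∣) (∣N∣≡d x) ⟨
      ∣ N x ∣ + ∣ N u ∪ N w ∣      ≡⟨ Disjoint⇒∣p∪q∣≡∣p∣+∣q∣ (N x) (N u ∪ N w) Nx#Nu∪Nw ⟨
      ∣ N x ∪ (N u ∪ N w) ∣        ≤⟨ ∣p∣≤n _ ⟩
      n                            ∎
      where
      open ≤-Reasoning
      Nx#Nu∪Nw : Disjoint (N x) (N u ∪ N w)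
      Nx#Nu∪Nw xk k∈ with ∈-∪⁻ (N u) (N w) k∈
      ... | inj₁ uk = TriangleFree⇒Disjoint tf xu xk uk
      ... | inj₂ wk = TriangleFree⇒Disjoint tf xw xk wk

    nonadjacent⇒d≤1+∣Nu∩Nw∣ : n ≡ suc (d + d) → ∀ {u w} → u ≢ w → w ∉ N u → d ≤ suc ∣ N u ∩ N w ∣
    nonadjacent⇒d≤1+∣Nu∩Nw∣ n≡2d+1 {u} {w} u≢w w∉Nu =
      +-cancelˡ-≤ (d + d) d (suc ∣ N u ∩ N w ∣) (begin
      (d + d) + d                               ≡⟨ +-comm (d + d) d ⟩
      d + (d + d)                               ≡⟨ cong (d +_) (∣N∪N∣+∣N∩N∣≡2d u w) ⟨
      d + (∣ N u ∪ N w ∣ + ∣ N u ∩ N w ∣)       ≡⟨ +-assoc d _ _ ⟨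
      d + ∣ N u ∪ N w ∣ + ∣ N u ∩ N w ∣         ≤⟨ +-monoˡ-≤ _ d+∣Nu∪Nw∣≤n ⟩
      n + ∣ N u ∩ N w ∣                         ≡⟨ cong (_+ ∣ N u ∩ N w ∣) n≡2d+1 ⟩
      suc (d + d) + ∣ N u ∩ N w ∣               ≡⟨ +-suc (d + d) _ ⟨
      (d + d) + suc ∣ N u ∩ N w ∣               ∎)
      where
      open ≤-Reasoning
      eq = ∣N[u]∪N[w]∣+∣Nu∩Nw∣≡2+2d u≢w w∉Nu
      0<∣Nu∩Nw∣ : 0 < ∣ N u ∩ N w ∣
      0<∣Nu∩Nw∣ = n≢0⇒n>0 λ ∣Nu∩Nw∣≡0 → <-irrefl refl (begin
        suc (suc (d + d))                      ≡⟨ eq ⟨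
        ∣ N[ u ] ∪ N[ w ] ∣ + ∣ N u ∩ N w ∣    ≡⟨ cong (∣ N[ u ] ∪ N[ w ] ∣ +_) ∣Nu∩Nw∣≡0 ⟩
        ∣ N[ u ] ∪ N[ w ] ∣ + 0                ≡⟨ +-identityʳ _ ⟩
        ∣ N[ u ] ∪ N[ w ] ∣                    ≤⟨ ∣p∣≤n (N[ u ] ∪ N[ w ]) ⟩
        n                                      ≡⟨ n≡2d+1 ⟩
        suc (d + d)                            ∎)
      d+∣Nu∪Nw∣≤n : d + ∣ N u ∪ N w ∣ ≤ n
      d+∣Nu∪Nw∣≤n with 0<∣p∣⇒∃∈ (N u ∩ N w) 0<∣Nu∩Nw∣
      ... | x , x∈ = let ux , wx = ∈-∩⁻ (N u) (N w) x∈ in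
                     common-neighbour⇒d+∣Nu∪Nw∣≤n (∼-sym ux) (∼-sym wx)

    triangleFree⇒n≢2d+1 : 3 ≤ d → ∀ {a b} → a ∼[ G ] b → n ≢ suc (d + d)
    triangleFree⇒n≢2d+1 3≤d {a} {b} ab n≡2d+1
      with Disjoint⇒∃outside (TriangleFree⇒Disjoint tf ab) n≡2d+1
    ... | w , w∉Na , w∉Nb = <⇒≱ 3≤d (+-cancelˡ-≤ d d 2 (begin
      d + d                                   ≤⟨ +-mono-≤ (d≤1+∣N∩Nw∣ w≢a w∉Na) (d≤1+∣N∩Nw∣ w≢b w∉Nb) ⟩
      suc ∣ N a ∩ N w ∣ + suc ∣ N b ∩ N w ∣   ≡⟨ cong suc (+-suc _ _) ⟩
      2 + (∣ N a ∩ N w ∣ + ∣ N b ∩ N w ∣)     ≤⟨ +-monoʳ-≤ 2 ∣Na∩Nw∣+∣Nb∩Nw∣≤d ⟩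
      2 + d                                   ≡⟨ +-comm 2 d ⟩
      d + 2                                   ∎))
      where
      open ≤-Reasoning
      a#b = TriangleFree⇒Disjoint tf ab
      w≢a = ∉∧∈⇒≢ (N b) w∉Nb (∼-sym ab)
      w≢b = ∉∧∈⇒≢ (N a) w∉Na ab
      d≤1+∣N∩Nw∣ : ∀ {u} → w ≢ u → w ∉ N u → d ≤ suc ∣ N u ∩ N w ∣
      d≤1+∣N∩Nw∣ w≢u = nonadjacent⇒d≤1+∣Nu∩Nw∣ n≡2d+1 (w≢u ∘ sym)
      Naw#Nbw : Disjoint (N a ∩ N w) (N b ∩ N w)
      Naw#Nbw {i} i∈Naw i∈Nbw =
        let ai , _ = ∈-∩⁻ (N a) (N w) i∈Naw; bi , _ = ∈-∩⁻ (N b) (N w) i∈Nbw in a#b ai bi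
      ⊆Nw : N a ∩ N w ∪ N b ∩ N w ⊆ N w
      ⊆Nw {i} i∈ with ∈-∪⁻ (N a ∩ N w) (N b ∩ N w) i∈
      ... | inj₁ i∈Naw = let _ , wi = ∈-∩⁻ (N a) (N w) i∈Naw in wi
      ... | inj₂ i∈Nbw = let _ , wi = ∈-∩⁻ (N b) (N w) i∈Nbw in wi
      ∣Na∩Nw∣+∣Nb∩Nw∣≤d : ∣ N a ∩ N w ∣ + ∣ N b ∩ N w ∣ ≤ d
      ∣Na∩Nw∣+∣Nb∩Nw∣≤d = begin
        ∣ N a ∩ N w ∣ + ∣ N b ∩ N w ∣   ≡⟨ Disjoint⇒∣p∪q∣≡∣p∣+∣q∣ (N a ∩ N w) (N b ∩ N w) Naw#Nbw ⟨
        ∣ N a ∩ N w ∪ N b ∩ N w ∣       ≤⟨ p⊆q⇒∣p∣≤∣q∣ (N a ∩ N w ∪ N b ∩ N w) (N w) ⊆Nw ⟩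
        ∣ N w ∣                         ≡⟨ ∣N∣≡d w ⟩
        d                               ∎

    triangleFree⇒≅K : n ≡ d + d → ∀ {a b} → a ∼[ G ] b → G ≅ K d
    triangleFree⇒≅K n≡2d {a} {b} ab = bipartition⇒≅K G (N b) (∣N∣≡d b) ∣∁Nb∣≡d adj≡xor
      where
      a#b = TriangleFree⇒Disjoint tf ab
      ∣∁Nb∣≡d : ∣ ∁ (N b) ∣ ≡ d
      ∣∁Nb∣≡d = +-cancelˡ-≡ d _ _ (begin
        d + ∣ ∁ (N b) ∣          ≡⟨ cong (_+ ∣ ∁ (N b) ∣) (∣N∣≡d b) ⟨
        ∣ N b ∣ + ∣ ∁ (N b) ∣    ≡⟨ ∣p∣+∣∁p∣≡n (N b) ⟩
        n                        ≡⟨ n≡2d ⟩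
        d + d                    ∎)
        where open ≡-Reasoning
      ∉Nb⇒∈Na : ∀ {i} → i ∉ N b → i ∈ N a
      ∉Nb⇒∈Na {i} i∉Nb with ∈-∪⁻ (N a) (N b) (n≤∣p∣⇒∈ (N a ∪ N b) n≤∣Na∪Nb∣ i)
        where
        n≤∣Na∪Nb∣ : n ≤ ∣ N a ∪ N b ∣
        n≤∣Na∪Nb∣ = ≤-reflexive (trans n≡2d (sym (Disjoint⇒∣N∪N∣≡2d a#b)))
      ... | inj₁ i∈Na = i∈Na
      ... | inj₂ i∈Nb = ⊥-elim (not-¬ i∉Nb i∈Nb)
      Na⊆N : ∀ {i} → i ∈ N b → N a ⊆ N i
      Na⊆N {i} bi =
        p⊆q∧∣q∣≤∣p∣⇒q⊆p (N i) (N a) Ni⊆Na (≤-reflexive (trans (∣N∣≡d a) (sym (∣N∣≡d i))))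
        where
        Ni⊆Na : N i ⊆ N a
        Ni⊆Na ik = ∉Nb⇒∈Na (¬-not λ bk → TriangleFree⇒Disjoint tf bi bk ik)
      adj≡xor : ∀ i j → adj G i j ≡ N b i xor N b j
      adj≡xor i j with N b i in bi | N b j in bj
      ... | true  | true  = ¬-not λ ij → TriangleFree⇒Disjoint tf bi bj ij
      ... | true  | false = Na⊆N bi (∉Nb⇒∈Na bj)
      ... | false | true  = trans (Graph.sym G i j) (Na⊆N bj (∉Nb⇒∈Na bi))
      ... | false | false = ¬-not λ ij → TriangleFree⇒Disjoint tf (∉Nb⇒∈Na bi) (∉Nb⇒∈Na bj) ij

2*d≡d+d : ∀ d → 2 * d ≡ d + d
2*d≡d+d d = cong (d +_) (+-identityʳ d)

lemma2p3 : (d n : ℕ) → 3 ≤ d → (G : Graph n) → Regular d G →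
           suc d < n → n < 2 * suc d →
           (a b : Fin n) → a ∼[ G ] b →
           (n < 2 * d → EdgeInTriangle G a b)
           × (n ≡ 2 * d →
                (EdgeInTriangle G a b ⊎ EdgeInInducedC4 G a b)
                × (TriangleFree G → G ≅ K d))
           × (n ≡ suc (2 * d) →
                (EdgeInTriangle G a b ⊎ EdgeInInducedC4 G a b)
                × (TriangleFree G → G ≅ T d))
lemma2p3 d n 3≤d G regular _ _ a b ab = part-i , part-ii , part-iii
  where
  open Neighbourhoods G
  open RegularGraph G regular
  part-i : n < 2 * d → EdgeInTriangle G a b
  part-i n<2d with triangle-or-disjoint a b
  ... | inj₁ abc = abc
  ... | inj₂ a#b = ⊥-elim (<⇒≱ n<2d 2d≤n)
    where
    2d≤n : 2 * d ≤ n
    2d≤n = subst (_≤ n) (trans (Disjoint⇒∣N∪N∣≡2d a#b) (sym (2*d≡d+d d))) (∣p∣≤n (N a ∪ N b))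
  part-ii : n ≡ 2 * d →
            (EdgeInTriangle G a b ⊎ EdgeInInducedC4 G a b) × (TriangleFree G → G ≅ K d)
  part-ii n≡2d = triangle-or-induced-C4 3≤d (inj₁ n≡d+d) ab , λ tf → triangleFree⇒≅K tf n≡d+d ab
    where n≡d+d = trans n≡2d (2*d≡d+d d)
  part-iii : n ≡ suc (2 * d) →
             (EdgeInTriangle G a b ⊎ EdgeInInducedC4 G a b) × (TriangleFree G → G ≅ T d)
  part-iii n≡2d+1 = triangle-or-induced-C4 3≤d (inj₂ n≡d+d+1) ab ,
                    λ tf → ⊥-elim (triangleFree⇒n≢2d+1 tf 3≤d ab n≡d+d+1)
    where n≡d+d+1 = trans n≡2d+1 (cong suc (2*d≡d+d d))
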